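{- Let $M$ be a finite set and let $\Pr_S\colon M\to[0,1]$ be a probability measure on $M$. Let $P=\{\Pr_S(m)\mid m\in M\}$ be the set of probabilities that occur. Then for every positive integer $i$ there is a $j\in\{6i+1,\ldots,8i\}$ such that $$\left[\frac{j-1/4}{8i^2},\frac{j+1/4}{8i^2}\right]\cap P=\emptyset.$$ -}

module Defs where

open import Level using (_⊔_)
open import Data.Nat as ℕ using (ℕ; zero; suc)
open import Data.Fin as F using (Fin)
open import Relation.Nullary using (¬_)
open import Relation.Binary.Core using (Rel)
open import Algebra.Structures using (IsCommutativeRing)
open import Relation.Binary.Structures using (IsTotalOrder)

-- An ordered field (the real numbers ℝ are one).  Inversion is total,
-- with the usual convention that only x ≉ 0 is constrained.
record OrderedField c ℓ₁ ℓ₂ : Set (Level.suc (c ⊔ ℓ₁ ⊔ ℓ₂)) where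
  infix  4 _≈_ _≤_
  infixl 7 _*_
  infixl 6 _+_ _-_
  field
    Carrier : Set c
    _≈_     : Rel Carrier ℓ₁
    _≤_     : Rel Carrier ℓ₂
    _+_     : Carrier → Carrier → Carrier
    _*_     : Carrier → Carrier → Carrier
    -_      : Carrier → Carrier
    0#      : Carrier
    1#      : Carrier
    _⁻¹     : Carrier → Carrier
    isCommutativeRing : IsCommutativeRing _≈_ _+_ _*_ -_ 0# 1#
    isTotalOrder      : IsTotalOrder _≈_ _≤_
    0≉1               : ¬ (0# ≈ 1#)
    ⁻¹-inverse        : ∀ x → ¬ (x ≈ 0#) → x * (x ⁻¹) ≈ 1#
    +-monoˡ-≤         : ∀ {x y} z → x ≤ y → x + z ≤ y + z
    *-nonneg          : ∀ {x y} → 0# ≤ x → 0# ≤ y → 0# ≤ x * y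

  _-_ : Carrier → Carrier → Carrier
  x - y = x + (- y)

  fromℕ : ℕ → Carrier
  fromℕ zero    = 0#
  fromℕ (suc n) = 1# + fromℕ n

  ∑ : ∀ {n} → (Fin n → Carrier) → Carrier
  ∑ {zero}  f = 0#
  ∑ {suc n} f = f F.zero + ∑ (λ k → f (F.suc k))

record ProbabilityMeasure {c ℓ₁ ℓ₂} (F : OrderedField c ℓ₁ ℓ₂) (n : ℕ) : Set (c ⊔ ℓ₁ ⊔ ℓ₂) where
  open OrderedField F
  field
    Pr       : Fin n → Carrier
    Pr-nonneg : ∀ m → 0# ≤ Pr m
    Pr-≤1     : ∀ m → Pr m ≤ 1#
    Pr-total  : ∑ Pr ≈ 1#

-- The 2i intervals [(j - 1/4)/(8i²), (j + 1/4)/(8i²)] with 6i < j ≤ 8i are separated by the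
-- cut points (k + 1/2)/(8i²), and a mass lying in any of them exceeds 6i/(8i²).  If every one of
-- them contained a mass, these masses would be distinct and add up to more than 2i·6i/(8i²) > 1.
-- Membership in an interval is not decidable over an ordered field, so each mass is instead sorted,
-- using totality of the order, into the gap between consecutive cut points containing it: a mass in
-- the j-th interval can only land in gap j, and an index j in range that is no mass's gap is found
-- by a finite search.

module Submission where

open import Defs
open import Data.Nat as ℕ using (ℕ; NonZero)
open import Data.Fin as Fin using (Fin; toℕ)
open import Data.Product using (∃; _×_; _,_)
open import Relation.Nullary using (¬_)

open import Algebra.Bundles using (CommutativeRing)
import Algebra.Properties.Ring as RingProperties
import Algebra.Solver.Ring.NaturalCoefficients.Default as NaturalCoefficientsSolver
import Data.Fin.Properties as Finₚ
open import Data.List using (List; length; catMaybes; tabulate)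
open import Data.List.Membership.Propositional using (_∈_; _∉_)
open import Data.List.Membership.DecPropositional ℕ._≟_ using (_∈?_)
import Data.List.Membership.Setoid.Properties as Membershipₚ
open import Data.List.Relation.Unary.Any using (here; there)
open import Data.Maybe using (Maybe; just; nothing; _<∣>_)
import Data.Nat.Properties as ℕₚ
open import Data.Nat.Tactic.RingSolver using (solve-∀)
open import Data.Sum using (inj₁; inj₂)
open import Function.Base using (_∘_)
open import Function.Definitions using (Injective)
open import Relation.Binary.Bundles using (TotalOrder)
import Relation.Binary.Construct.NonStrictToStrict as NonStrictToStrict
import Relation.Binary.Properties.Poset as PosetProperties
open import Relation.Binary.PropositionalEquality as ≡ using (_≡_; refl; cong; setoid)
import Relation.Binary.Reasoning.PartialOrder as PartialOrderReasoning
open import Relation.Nullary using (contradiction)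

module _ {a} {A : Set a} where

  hits : ∀ {n} → (Fin n → Maybe A) → List A
  hits h = catMaybes (tabulate h)

  ∈-hits : ∀ {n} (h : Fin n → Maybe A) {m j} → h m ≡ just j → j ∈ hits h
  ∈-hits h {Fin.zero} eq with h Fin.zero
  ∈-hits h {Fin.zero} refl | just _ = here refl
  ∈-hits h {Fin.suc m} eq with h Fin.zero
  ... | nothing = ∈-hits (h ∘ Fin.suc) eq
  ... | just _  = there (∈-hits (h ∘ Fin.suc) eq)

  injective⇒≤-length : ∀ {n xs} {g : Fin n → A} →
                       Injective _≡_ _≡_ g → (∀ t → g t ∈ xs) → n ℕ.≤ length xs
  injective⇒≤-length g-inj g∈xs = Finₚ.injective⇒≤ λ {t} {u} same-index →
    g-inj (Membershipₚ.index-injective (setoid A) (g∈xs t) (g∈xs u) same-index)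

module OrderedFieldProperties {c ℓ₁ ℓ₂} (F : OrderedField c ℓ₁ ℓ₂) where

  open OrderedField F

  commutativeRing : CommutativeRing c ℓ₁
  commutativeRing = record { isCommutativeRing = isCommutativeRing }

  totalOrder : TotalOrder c ℓ₁ ℓ₂
  totalOrder = record { isTotalOrder = isTotalOrder }

  open CommutativeRing commutativeRing
    using (ring; commutativeSemiring; sym; +-comm; +-assoc; +-identityˡ; +-identityʳ; -‿inverseˡ; -‿inverseʳ; -‿cong;
           +-congˡ; +-congʳ; *-comm; *-assoc; *-congˡ; *-congʳ; *-identityˡ; *-identityʳ; zeroˡ; zeroʳ; distribʳ)
  open RingProperties ring using (-‿distribˡ-*; -‿distribʳ-*; -‿involutive; +-identityʳ-unique; xyx⁻¹≈y)
  open TotalOrder totalOrder using (poset; total) renaming (refl to ≤-refl; trans to ≤-trans; reflexive to ≤-reflexive)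
  open PosetProperties poset public using (_<_; <⇒≉; ≤∧≉⇒<; <⇒≱)
  open NonStrictToStrict _≈_ _≤_ public using (<⇒≤)
  open PartialOrderReasoning poset

  +-monoʳ-≤ : ∀ z {x y} → x ≤ y → z + x ≤ z + y
  +-monoʳ-≤ z {x} {y} x≤y = begin
    z + x ≈⟨ +-comm z x ⟩
    x + z ≤⟨ +-monoˡ-≤ z x≤y ⟩
    y + z ≈⟨ +-comm y z ⟩
    z + y ∎

  +-mono-≤ : ∀ {a b x y} → a ≤ b → x ≤ y → a + x ≤ b + y
  +-mono-≤ {b = b} {x} a≤b x≤y = ≤-trans (+-monoˡ-≤ x a≤b) (+-monoʳ-≤ b x≤y)

  x≤x+p : ∀ x {p} → 0# ≤ p → x ≤ x + p
  x≤x+p x {p} 0≤p = begin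
    x      ≈⟨ +-identityʳ x ⟨
    x + 0# ≤⟨ +-monoʳ-≤ x 0≤p ⟩
    x + p  ∎

  x<x+p : ∀ x {p} → 0# < p → x < x + p
  x<x+p x {p} 0<p = ≤∧≉⇒< (x≤x+p x (<⇒≤ 0<p))
    λ x≈x+p → <⇒≉ 0<p (sym (+-identityʳ-unique x p (sym x≈x+p)))

  x≤0⇒0≤-x : ∀ {x} → x ≤ 0# → 0# ≤ - x
  x≤0⇒0≤-x {x} x≤0 = begin
    0#     ≈⟨ -‿inverseʳ x ⟨
    x - x  ≤⟨ +-monoˡ-≤ (- x) x≤0 ⟩
    0# - x ≈⟨ +-identityˡ (- x) ⟩
    - x    ∎

  0<1 : 0# < 1#
  0<1 = ≤∧≉⇒< 0≤1 0≉1
    where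
    0≤1 : 0# ≤ 1#
    0≤1 with total 0# 1#
    ... | inj₁ 0≤1 = 0≤1
    ... | inj₂ 1≤0 = begin
      0#            ≤⟨ *-nonneg 0≤-1 0≤-1 ⟩
      - 1# * - 1#   ≈⟨ -‿distribˡ-* 1# (- 1#) ⟨
      - (1# * - 1#) ≈⟨ -‿cong (*-identityˡ (- 1#)) ⟩
      - - 1#        ≈⟨ -‿involutive 1# ⟩
      1#            ∎
      where
      0≤-1 : 0# ≤ - 1#
      0≤-1 = x≤0⇒0≤-x 1≤0

  0<⇒≉0 : ∀ {x} → 0# < x → ¬ x ≈ 0#
  0<⇒≉0 0<x x≈0 = <⇒≉ 0<x (sym x≈0)

  +-pos : ∀ {x y} → 0# ≤ x → 0# < y → 0# < x + y
  +-pos {x} {y} 0≤x 0<y = begin-strict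
    0#    ≤⟨ 0≤x ⟩
    x     <⟨ x<x+p x 0<y ⟩
    x + y ∎

  ⁻¹-pos : ∀ {x} → 0# < x → 0# < x ⁻¹
  ⁻¹-pos {x} 0<x = ≤∧≉⇒< 0≤x⁻¹ λ 0≈x⁻¹ → 0≉1 (begin-equality
    0#        ≈⟨ zeroʳ x ⟨
    x * 0#    ≈⟨ *-congˡ 0≈x⁻¹ ⟩
    x * x ⁻¹  ≈⟨ x*x⁻¹≈1 ⟩
    1#        ∎)
    where
    x*x⁻¹≈1 : x * x ⁻¹ ≈ 1#
    x*x⁻¹≈1 = ⁻¹-inverse x (0<⇒≉0 0<x)

    0≤x⁻¹ : 0# ≤ x ⁻¹
    0≤x⁻¹ with total 0# (x ⁻¹)
    ... | inj₁ 0≤x⁻¹ = 0≤x⁻¹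
    ... | inj₂ x⁻¹≤0 = contradiction 1≤0 (<⇒≱ 0<1)
      where
      1≤0 : 1# ≤ 0#
      1≤0 = begin
        1#                ≈⟨ +-identityˡ 1# ⟨
        0# + 1#           ≤⟨ +-monoˡ-≤ 1# (*-nonneg (<⇒≤ 0<x) (x≤0⇒0≤-x x⁻¹≤0)) ⟩
        x * - (x ⁻¹) + 1# ≈⟨ +-congʳ (-‿distribʳ-* x (x ⁻¹)) ⟨
        - (x * x ⁻¹) + 1# ≈⟨ +-congʳ (-‿cong x*x⁻¹≈1) ⟩
        - 1# + 1#         ≈⟨ -‿inverseˡ 1# ⟩
        0#                ∎

  *-monoʳ-≤ : ∀ {a b c} → 0# ≤ c → a ≤ b → a * c ≤ b * c
  *-monoʳ-≤ {a} {b} {c} 0≤c a≤b = begin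
    a * c               ≤⟨ x≤x+p (a * c) (*-nonneg 0≤b-a 0≤c) ⟩
    a * c + (b - a) * c ≈⟨ distribʳ c a (b - a) ⟨
    (a + (b - a)) * c   ≈⟨ *-congʳ (+-assoc a b (- a)) ⟨
    (a + b - a) * c     ≈⟨ *-congʳ (xyx⁻¹≈y a b) ⟩
    b * c               ∎
    where
    0≤b-a : 0# ≤ b - a
    0≤b-a = begin
      0#    ≈⟨ -‿inverseʳ a ⟨
      a - a ≤⟨ +-monoˡ-≤ (- a) a≤b ⟩
      b - a ∎

  *-monoˡ-≤ : ∀ {a b c} → 0# ≤ c → a ≤ b → c * a ≤ c * b
  *-monoˡ-≤ {a} {b} {c} 0≤c a≤b = begin
    c * a ≈⟨ *-comm c a ⟩
    a * c ≤⟨ *-monoʳ-≤ 0≤c a≤b ⟩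
    b * c ≈⟨ *-comm b c ⟩
    c * b ∎

  *-monoʳ-< : ∀ {a b c} → 0# < c → a < b → a * c < b * c
  *-monoʳ-< {a} {b} {c} 0<c a<b = ≤∧≉⇒< (*-monoʳ-≤ (<⇒≤ 0<c) (<⇒≤ a<b)) λ ac≈bc → <⇒≉ a<b (begin-equality
    a                ≈⟨ *-identityʳ a ⟨
    a * 1#           ≈⟨ *-congˡ c*c⁻¹≈1 ⟨
    a * (c * c ⁻¹)   ≈⟨ *-assoc a c (c ⁻¹) ⟨
    a * c * c ⁻¹     ≈⟨ *-congʳ ac≈bc ⟩
    b * c * c ⁻¹     ≈⟨ *-assoc b c (c ⁻¹) ⟩
    b * (c * c ⁻¹)   ≈⟨ *-congˡ c*c⁻¹≈1 ⟩
    b * 1#           ≈⟨ *-identityʳ b ⟩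
    b                ∎)
    where
    c*c⁻¹≈1 : c * c ⁻¹ ≈ 1#
    c*c⁻¹≈1 = ⁻¹-inverse c (0<⇒≉0 0<c)

  fromℕ-nonneg : ∀ n → 0# ≤ fromℕ n
  fromℕ-nonneg ℕ.zero    = ≤-refl
  fromℕ-nonneg (ℕ.suc n) = ≤-trans (<⇒≤ 0<1) (x≤x+p 1# (fromℕ-nonneg n))

  fromℕ-pos : ∀ n .{{_ : NonZero n}} → 0# < fromℕ n
  fromℕ-pos (ℕ.suc n) = begin-strict
    0#           <⟨ 0<1 ⟩
    1#           ≤⟨ x≤x+p 1# (fromℕ-nonneg n) ⟩
    1# + fromℕ n ∎

  fromℕ-+ : ∀ m n → fromℕ (m ℕ.+ n) ≈ fromℕ m + fromℕ n
  fromℕ-+ ℕ.zero    n = sym (+-identityˡ (fromℕ n))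
  fromℕ-+ (ℕ.suc m) n = begin-equality
    1# + fromℕ (m ℕ.+ n)       ≈⟨ +-congˡ (fromℕ-+ m n) ⟩
    1# + (fromℕ m + fromℕ n)   ≈⟨ +-assoc 1# (fromℕ m) (fromℕ n) ⟨
    1# + fromℕ m + fromℕ n     ∎

  fromℕ-* : ∀ m n → fromℕ (m ℕ.* n) ≈ fromℕ m * fromℕ n
  fromℕ-* ℕ.zero    n = sym (zeroˡ (fromℕ n))
  fromℕ-* (ℕ.suc m) n = begin-equality
    fromℕ (n ℕ.+ m ℕ.* n)            ≈⟨ fromℕ-+ n (m ℕ.* n) ⟩
    fromℕ n + fromℕ (m ℕ.* n)        ≈⟨ +-congˡ (fromℕ-* m n) ⟩
    fromℕ n + fromℕ m * fromℕ n      ≈⟨ +-congʳ (*-identityˡ (fromℕ n)) ⟨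
    1# * fromℕ n + fromℕ m * fromℕ n ≈⟨ distribʳ (fromℕ n) 1# (fromℕ m) ⟨
    (1# + fromℕ m) * fromℕ n         ∎

  fromℕ-mono-< : ∀ {m n} → m ℕ.< n → fromℕ m < fromℕ n
  fromℕ-mono-< {m} m<n with ℕₚ.m≤n⇒∃[o]m+o≡n m<n
  ... | o , refl = begin-strict
    fromℕ m                     <⟨ x<x+p (fromℕ m) (fromℕ-pos (ℕ.suc o)) ⟩
    fromℕ m + fromℕ (ℕ.suc o)   ≈⟨ fromℕ-+ m (ℕ.suc o) ⟨
    fromℕ (m ℕ.+ ℕ.suc o)       ≡⟨ cong fromℕ (ℕₚ.+-suc m o) ⟩
    fromℕ (ℕ.suc m ℕ.+ o)       ∎

  count*≤∑ : ∀ {n} (P : Fin n → Carrier) (h : Fin n → Maybe ℕ) {c} →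
             (∀ m → 0# ≤ P m) → (∀ m {j} → h m ≡ just j → c ≤ P m) →
             fromℕ (length (hits h)) * c ≤ ∑ P
  count*≤∑ {ℕ.zero}  P h {c} _ _ = ≤-reflexive (zeroˡ c)
  count*≤∑ {ℕ.suc n} P h {c} 0≤P c≤P
    with h Fin.zero in h₀≡ | count*≤∑ (P ∘ Fin.suc) (h ∘ Fin.suc) (0≤P ∘ Fin.suc) (c≤P ∘ Fin.suc)
  ... | nothing | tail≤ = begin
    fromℕ (length (hits (h ∘ Fin.suc))) * c ≤⟨ tail≤ ⟩
    ∑ (P ∘ Fin.suc)                         ≈⟨ +-identityˡ _ ⟨
    0# + ∑ (P ∘ Fin.suc)                    ≤⟨ +-monoˡ-≤ _ (0≤P Fin.zero) ⟩
    P Fin.zero + ∑ (P ∘ Fin.suc)            ∎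
  ... | just _  | tail≤ = begin
    (1# + fromℕ (length (hits (h ∘ Fin.suc)))) * c   ≈⟨ distribʳ c 1# _ ⟩
    1# * c + fromℕ (length (hits (h ∘ Fin.suc))) * c ≈⟨ +-congʳ (*-identityˡ c) ⟩
    c + fromℕ (length (hits (h ∘ Fin.suc))) * c      ≤⟨ +-mono-≤ (c≤P Fin.zero h₀≡) tail≤ ⟩
    P Fin.zero + ∑ (P ∘ Fin.suc)                     ∎

module Bucketing {a ℓ₁ ℓ₂} (O : TotalOrder a ℓ₁ ℓ₂) (cut : ℕ → TotalOrder.Carrier O) where

  open TotalOrder O using (Carrier; _≤_; total; poset)
  open PosetProperties poset using (_<_; <⇒≱)

  bucket : Carrier → ℕ → ℕ → Maybe ℕ
  bucket x s ℕ.zero    = nothing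
  bucket x s (ℕ.suc n) with total x (cut s)
  ... | inj₁ _ = nothing
  ... | inj₂ _ = bucket x (ℕ.suc s) n <∣> just (ℕ.suc s)

  bucket-just⇒cut≤ : ∀ x s n {j} → bucket x s n ≡ just j → cut s ≤ x
  bucket-just⇒cut≤ x s (ℕ.suc n) eq with total x (cut s)
  bucket-just⇒cut≤ x s (ℕ.suc n) () | inj₁ _
  ... | inj₂ cut≤x = cut≤x

  bucket-below : ∀ {x} s n → x < cut s → bucket x s n ≡ nothing
  bucket-below {x} s ℕ.zero    _     = refl
  bucket-below {x} s (ℕ.suc n) x<cut with total x (cut s)
  ... | inj₁ _     = refl
  ... | inj₂ cut≤x = contradiction cut≤x (<⇒≱ x<cut)

  bucket-≡ : ∀ {x} s n {j} → s ℕ.< j → j ℕ.≤ s ℕ.+ n →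
             (∀ {k} → k ℕ.< j → cut k < x) → x < cut j → bucket x s n ≡ just j
  bucket-≡ s ℕ.zero {j} s<j j≤s+0 _ _ =
    contradiction (ℕₚ.≤-trans j≤s+0 (ℕₚ.≤-reflexive (ℕₚ.+-identityʳ s))) (ℕₚ.<⇒≱ s<j)
  bucket-≡ {x} s (ℕ.suc n) {j} s<j j≤s+1+n cut<x x<cut with total x (cut s)
  ... | inj₁ x≤cut = contradiction x≤cut (<⇒≱ (cut<x s<j))
  ... | inj₂ _ with ℕₚ.m≤n⇒m<n∨m≡n s<j
  ...   | inj₁ 1+s<j = cong (_<∣> just (ℕ.suc s))
          (bucket-≡ (ℕ.suc s) n 1+s<j (ℕₚ.≤-trans j≤s+1+n (ℕₚ.≤-reflexive (ℕₚ.+-suc s n))) cut<x x<cut)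
  ...   | inj₂ refl  = cong (_<∣> just (ℕ.suc s)) (bucket-below (ℕ.suc s) n x<cut)

module QuarterGrid {c ℓ₁ ℓ₂} (F : OrderedField c ℓ₁ ℓ₂) (D : OrderedField.Carrier F)
                   (0<D : OrderedFieldProperties._<_ F (OrderedField.0# F) D) where

  open OrderedField F
  open OrderedFieldProperties F
  open CommutativeRing commutativeRing
    using (commutativeSemiring; sym; +-assoc; +-cong; +-congˡ; +-congʳ; +-identityʳ; -‿inverseʳ)
    renaming (refl to ≈-refl)
  open NaturalCoefficientsSolver commutativeSemiring using (solve; _:=_; _:+_; _:*_; con)
  open PartialOrderReasoning (TotalOrder.poset totalOrder)

  quarter : Carrier
  quarter = fromℕ 4 ⁻¹

  lower upper cut : ℕ → Carrier
  lower j = (fromℕ j - quarter) * D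
  upper j = (fromℕ j + quarter) * D
  cut   k = (fromℕ k + (quarter + quarter)) * D

  0<quarter : 0# < quarter
  0<quarter = ⁻¹-pos (fromℕ-pos 4)

  four-quarters : quarter + quarter + quarter + quarter ≈ 1#
  -- The coefficient (con 1 :+ (… :+ con 0)) evaluates to fromℕ 4 on the nose, unlike con 4.
  four-quarters = begin-equality
    quarter + quarter + quarter + quarter
      ≈⟨ solve 1 (λ q → q :+ q :+ q :+ q := (con 1 :+ (con 1 :+ (con 1 :+ (con 1 :+ con 0)))) :* q) ≈-refl quarter ⟩
    fromℕ 4 * quarter                     ≈⟨ ⁻¹-inverse (fromℕ 4) (0<⇒≉0 (fromℕ-pos 4)) ⟩
    1#                                    ∎

  upper<cut : ∀ j → upper j < cut j
  upper<cut j = *-monoʳ-< 0<D (begin-strict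
    fromℕ j + quarter             <⟨ x<x+p _ 0<quarter ⟩
    fromℕ j + quarter + quarter   ≈⟨ +-assoc _ quarter quarter ⟩
    fromℕ j + (quarter + quarter) ∎)

  k*D≤cut : ∀ k → fromℕ k * D ≤ cut k
  k*D≤cut k = *-monoʳ-≤ (<⇒≤ 0<D) (x≤x+p (fromℕ k) (<⇒≤ (+-pos (<⇒≤ 0<quarter) 0<quarter)))

  cut<lower : ∀ {k j} → k ℕ.< j → cut k < lower j
  cut<lower {k} k<j with ℕₚ.m≤n⇒∃[o]m+o≡n k<j
  ... | t , refl = *-monoʳ-< 0<D (begin-strict
    K + (q + q)                                    <⟨ x<x+p _ (+-pos (fromℕ-nonneg t) 0<quarter) ⟩
    K + (q + q) + (T + q)                          ≈⟨ +-identityʳ _ ⟨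
    K + (q + q) + (T + q) + 0#                     ≈⟨ +-congˡ (-‿inverseʳ q) ⟨
    K + (q + q) + (T + q) + (q - q)                ≈⟨ solve 4 (λ K T q q⁻ →
                                                        K :+ (q :+ q) :+ (T :+ q) :+ (q :+ q⁻) :=
                                                        q :+ q :+ q :+ q :+ (K :+ T) :+ q⁻) ≈-refl K T q (- q) ⟩
    q + q + q + q + (K + T) - q                    ≈⟨ +-congʳ (+-cong four-quarters (sym (fromℕ-+ k t))) ⟩
    1# + fromℕ (k ℕ.+ t) - q                       ∎)
    where
    q K T : Carrier
    q = quarter
    K = fromℕ k
    T = fromℕ t

  open Bucketing totalOrder cut public

  bucket-of-interval : ∀ {x} s n {j} → s ℕ.< j → j ℕ.≤ s ℕ.+ n →
                       lower j ≤ x → x ≤ upper j → bucket x s n ≡ just j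
  bucket-of-interval {x} s n {j} s<j j≤s+n lower≤x x≤upper = bucket-≡ s n s<j j≤s+n cut<x x<cut
    where
    cut<x : ∀ {k} → k ℕ.< j → cut k < x
    cut<x {k} k<j = begin-strict
      cut k   <⟨ cut<lower k<j ⟩
      lower j ≤⟨ lower≤x ⟩
      x       ∎
    x<cut : x < cut j
    x<cut = begin-strict
      x       ≤⟨ x≤upper ⟩
      upper j <⟨ upper<cut j ⟩
      cut j   ∎

8i²<N*6i : ∀ i {N} .{{_ : NonZero i}} → 2 ℕ.* i ℕ.≤ N → 8 ℕ.* (i ℕ.* i) ℕ.< N ℕ.* (6 ℕ.* i)
8i²<N*6i i {N} 2i≤N = begin-strict
  8 ℕ.* (i ℕ.* i)         <⟨ ℕₚ.*-monoˡ-< (i ℕ.* i) {{ℕₚ.m*n≢0 i i}} (ℕₚ.m<m+n 8 {4} ℕ.z<s) ⟩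
  12 ℕ.* (i ℕ.* i)        ≡⟨ 12i²≡2i*6i i ⟩
  2 ℕ.* i ℕ.* (6 ℕ.* i)   ≤⟨ ℕₚ.*-monoˡ-≤ (6 ℕ.* i) 2i≤N ⟩
  N ℕ.* (6 ℕ.* i)         ∎
  where
  open ℕₚ.≤-Reasoning
  12i²≡2i*6i : ∀ i → 12 ℕ.* (i ℕ.* i) ≡ 2 ℕ.* i ℕ.* (6 ℕ.* i)
  12i²≡2i*6i = solve-∀

module ProbabilityGap {c ℓ₁ ℓ₂} (F : OrderedField c ℓ₁ ℓ₂) (i : ℕ) .{{_ : NonZero i}}
                      {n} (μ : ProbabilityMeasure F n) where

  open OrderedField F
  open ProbabilityMeasure μ
  open OrderedFieldProperties F
  open CommutativeRing commutativeRing using (*-assoc; *-congʳ)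
  open PartialOrderReasoning (TotalOrder.poset totalOrder)

  d : Carrier
  d = fromℕ (8 ℕ.* (i ℕ.* i))

  0<d : 0# < d
  0<d = fromℕ-pos (8 ℕ.* (i ℕ.* i)) {{ℕₚ.m*n≢0 8 (i ℕ.* i) {{_}} {{ℕₚ.m*n≢0 i i}}}}

  open QuarterGrid F (d ⁻¹) (⁻¹-pos 0<d) public

  buckets : Fin n → Maybe ℕ
  buckets m = bucket (Pr m) (6 ℕ.* i) (2 ℕ.* i)

  candidate : Fin (2 ℕ.* i) → ℕ
  candidate t = ℕ.suc (6 ℕ.* i ℕ.+ toℕ t)

  candidate-injective : Injective _≡_ _≡_ candidate
  candidate-injective = Finₚ.toℕ-injective ∘ ℕₚ.+-cancelˡ-≡ (6 ℕ.* i) _ _ ∘ ℕₚ.suc-injective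

  6i<candidate : ∀ t → 6 ℕ.* i ℕ.< candidate t
  6i<candidate t = ℕ.s≤s (ℕₚ.m≤m+n (6 ℕ.* i) (toℕ t))

  candidate≤6i+2i : ∀ t → candidate t ℕ.≤ 6 ℕ.* i ℕ.+ 2 ℕ.* i
  candidate≤6i+2i t = ℕₚ.+-monoʳ-< (6 ℕ.* i) (Finₚ.toℕ<n t)

  candidate≤8i : ∀ t → candidate t ℕ.≤ 8 ℕ.* i
  candidate≤8i t = ℕₚ.≤-trans (candidate≤6i+2i t) (ℕₚ.≤-reflexive (≡.sym (ℕₚ.*-distribʳ-+ i 6 2)))

  1<N*cut[6i] : ∀ {N} → 2 ℕ.* i ℕ.≤ N → 1# < fromℕ N * cut (6 ℕ.* i)
  1<N*cut[6i] {N} 2i≤N = begin-strict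
    1#                                   ≈⟨ ⁻¹-inverse d (0<⇒≉0 0<d) ⟨
    d * d ⁻¹                             <⟨ *-monoʳ-< (⁻¹-pos 0<d) (fromℕ-mono-< (8i²<N*6i i 2i≤N)) ⟩
    fromℕ (N ℕ.* (6 ℕ.* i)) * d ⁻¹       ≈⟨ *-congʳ (fromℕ-* N (6 ℕ.* i)) ⟩
    fromℕ N * fromℕ (6 ℕ.* i) * d ⁻¹     ≈⟨ *-assoc (fromℕ N) (fromℕ (6 ℕ.* i)) (d ⁻¹) ⟩
    fromℕ N * (fromℕ (6 ℕ.* i) * d ⁻¹)   ≤⟨ *-monoˡ-≤ (fromℕ-nonneg N) (k*D≤cut (6 ℕ.* i)) ⟩
    fromℕ N * cut (6 ℕ.* i)              ∎

  not-every-candidate-hit : ¬ (∀ t → candidate t ∈ hits buckets)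
  not-every-candidate-hit all-hit =
    <⇒≱ (1<N*cut[6i] (injective⇒≤-length candidate-injective all-hit)) (begin
      fromℕ (length (hits buckets)) * cut (6 ℕ.* i) ≤⟨ count*≤∑ Pr buckets Pr-nonneg cut[6i]≤Pr ⟩
      ∑ Pr                                          ≈⟨ Pr-total ⟩
      1#                                            ∎)
    where
    cut[6i]≤Pr : ∀ m {j} → buckets m ≡ just j → cut (6 ℕ.* i) ≤ Pr m
    cut[6i]≤Pr m = bucket-just⇒cut≤ (Pr m) (6 ℕ.* i) (2 ℕ.* i)

  some-candidate-missed : ∃ λ t → candidate t ∉ hits buckets
  some-candidate-missed = Finₚ.¬∀⟶∃¬ (2 ℕ.* i) _ (λ t → candidate t ∈? hits buckets) not-every-candidate-hit

lemma1 : ∀ {c ℓ₁ ℓ₂} (F : OrderedField c ℓ₁ ℓ₂) (n : ℕ) (μ : ProbabilityMeasure F n) →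
         (i : ℕ) → .{{_ : NonZero i}} →
         let open OrderedField F
             open ProbabilityMeasure μ
             quarter = (fromℕ 4) ⁻¹
             d = fromℕ (8 ℕ.* (i ℕ.* i))
         in ∃ λ j → ℕ.suc (6 ℕ.* i) ℕ.≤ j × j ℕ.≤ 8 ℕ.* i ×
              ¬ (∃ λ (m : Fin n) → (fromℕ j - quarter) * d ⁻¹ ≤ Pr m × Pr m ≤ (fromℕ j + quarter) * d ⁻¹)
lemma1 F n μ i =
  let open ProbabilityGap F i μ
      t , missed = some-candidate-missed
  in candidate t , 6i<candidate t , candidate≤8i t ,
     λ (m , lower≤Pr , Pr≤upper) → missed (∈-hits buckets
       (bucket-of-interval (6 ℕ.* i) (2 ℕ.* i) (6i<candidate t) (candidate≤6i+2i t) lower≤Pr Pr≤upper))
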